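{- Suppose $n\ge 7$. Let $F$ be a facet of ${\tt vdW}(n,2)$ whose increment is the largest odd integer $d$ occurring as the increment of a facet of ${\tt vdW}(n,2)$. If $G$ is any other facet of ${\tt vdW}(n,2)$ with increment $d'\ne d$, then $|F\cap G|\le 1$.
   Context: Let $V=\{x_1,\ldots,x_n\}$ and $0<k<n$. The van der Waerden complex ${\tt vdW}(n,k)$ is the simplicial complex on $V$ whose facets are exactly the sets $\{x_i,x_{i+d},x_{i+2d},\ldots,x_{i+kd}\}$ for integers $d$ and $i$ with $1\le i<i+kd\le n$ (so $d\ge1$). For such a facet, the integer $d$ is called its increment. -}

module Defs where

open import Data.Nat using (ℕ; suc; _+_; _*_; _≤_; _<_)
open import Data.Nat.Properties using (_≟_)
open import Data.List using (List; _∷_; []; filter; length)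
open import Data.List.Membership.DecPropositional _≟_ using (_∈?_)
open import Data.Product using (Σ; _×_)
open import Relation.Binary.PropositionalEquality using (_≡_)

-- Vertex x_j is represented by the natural number j (1 ≤ j ≤ n).
record Facet (n k : ℕ) : Set where
  constructor facet
  field
    start     : ℕ
    increment : ℕ
    start≥1   : 1 ≤ start
    incr≥1    : 1 ≤ increment
    fits      : start + k * increment ≤ n

open Facet public

progression : ℕ → ℕ → ℕ → List ℕ
progression i d 0       = i ∷ []
progression i d (suc m) = i ∷ progression (i + d) d m

vertices : ∀ {n k} → Facet n k → List ℕ
vertices {k = k} F = progression (start F) (increment F) k

_∩_ : ∀ {n k} → Facet n k → Facet n k → List ℕ
F ∩ G = filter (_∈? vertices G) (vertices F)

∣_∩_∣ : ∀ {n k} → Facet n k → Facet n k → ℕ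
∣ F ∩ G ∣ = length (F ∩ G)

Odd : ℕ → Set
Odd d = Σ ℕ (λ m → d ≡ suc (2 * m))

IsIncrement : ℕ → ℕ → ℕ → Set
IsIncrement n k d = Σ (Facet n k) (λ F → increment F ≡ d)

LargestOddIncrement : ℕ → ℕ → ℕ → Set
LargestOddIncrement n k d =
  Odd d × IsIncrement n k d × (∀ e → Odd e → IsIncrement n k e → e ≤ d)

-- Two vertices of F differ by d or 2d, and two vertices of G by e or 2e, where e ≠ d is the
-- increment of G. Sharing two vertices would force d = 2e, impossible as d is odd, or
-- e = 2d; but then G needs 1 + 4d ≤ n, leaving room for the larger odd increment d + 2.
module Submission where

open import Defs
open import Data.Nat using (ℕ; zero; suc; _+_; _*_; _∸_; _%_; _≤_; _<_; _≤?_; z≤n; s≤s)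
open import Data.Nat.Properties
open import Data.Nat.DivMod using ([m+kn]%n≡m%n; m*n%n≡0)
open import Data.List using (_∷_; []; filter; length)
open import Data.List.Properties using (filter-none)
open import Data.List.Relation.Unary.Any using (here; there)
open import Data.List.Relation.Unary.All as All using (All)
open import Data.List.Relation.Unary.AllPairs as AllPairs using (AllPairs; []; _∷_)
open import Data.List.Membership.DecPropositional _≟_ using (_∈_; _∈?_)
open import Data.Product using (_×_; _,_; proj₁; ∃-syntax)
open import Data.Sum using (_⊎_; inj₁; inj₂)
open import Level using (Level)
open import Relation.Unary using (Pred; Decidable)
open import Relation.Nullary using (¬_; yes; no; contradiction)
open import Relation.Binary.PropositionalEquality

length-filter≤1 : ∀ {a p : Level} {A : Set a} {P : Pred A p} (P? : Decidable P) {xs} →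
  AllPairs (λ x y → ¬ (P x × P y)) xs → length (filter P? xs) ≤ 1
length-filter≤1 P? {[]} [] = z≤n
length-filter≤1 P? {x ∷ xs} (excl ∷ rest) with P? x
... | yes px = s≤s (≤-reflexive (cong length
                      (filter-none P? (All.map (λ ¬pxy py → ¬pxy (px , py)) excl))))
... | no _   = length-filter≤1 P? rest

odd⇒≢double : ∀ {d} e → Odd d → d ≢ 2 * e
odd⇒≢double e (m , refl) eq = 1+n≢0 (begin
  1                  ≡⟨ sym ([m+kn]%n≡m%n 1 m 2) ⟩
  (1 + m * 2) % 2    ≡⟨ cong (λ x → (1 + x) % 2) (*-comm m 2) ⟩
  (1 + 2 * m) % 2    ≡⟨ cong (_% 2) eq ⟩
  (2 * e) % 2        ≡⟨ cong (_% 2) (*-comm 2 e) ⟩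
  (e * 2) % 2        ≡⟨ m*n%n≡0 e 2 ⟩
  0                  ∎)
  where open ≡-Reasoning

Odd-2+ : ∀ {d} → Odd d → Odd (2 + d)
Odd-2+ (m , eq) = suc m , trans (cong (2 +_) eq) (cong suc (sym (*-suc 2 m)))

1≤c≤2⇒c≡1⊎c≡2 : ∀ {c} → 1 ≤ c → c ≤ 2 → c ≡ 1 ⊎ c ≡ 2
1≤c≤2⇒c≡1⊎c≡2 (s≤s z≤n) (s≤s z≤n)       = inj₁ refl
1≤c≤2⇒c≡1⊎c≡2 (s≤s z≤n) (s≤s (s≤s z≤n)) = inj₂ refl

∈-progression⁻ : ∀ {x} i d k → x ∈ progression i d k → ∃[ a ] a ≤ k × x ≡ i + a * d
∈-progression⁻ i d zero    (here refl) = 0 , z≤n , sym (+-identityʳ i)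
∈-progression⁻ i d (suc k) (here refl) = 0 , z≤n , sym (+-identityʳ i)
∈-progression⁻ i d (suc k) (there x∈) with ∈-progression⁻ (i + d) d k x∈
... | a , a≤k , refl = suc a , s≤s a≤k , +-assoc i d (a * d)

progression-gaps : ∀ i d k →
  AllPairs (λ x y → ∃[ c ] (1 ≤ c × c ≤ k) × y ≡ x + c * d) (progression i d k)
progression-gaps i d zero    = All.[] ∷ []
progression-gaps i d (suc k) =
  All.tabulate later ∷ AllPairs.map widen (progression-gaps (i + d) d k)
  where
  later : ∀ {y} → y ∈ progression (i + d) d k →
          ∃[ c ] (1 ≤ c × c ≤ suc k) × y ≡ i + c * d
  later y∈ with ∈-progression⁻ (i + d) d k y∈
  ... | a , a≤k , refl = suc a , (s≤s z≤n , s≤s a≤k) , +-assoc i d (a * d)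
  widen : ∀ {x y} → ∃[ c ] (1 ≤ c × c ≤ k) × y ≡ x + c * d →
          ∃[ c ] (1 ≤ c × c ≤ suc k) × y ≡ x + c * d
  widen (c , (1≤c , c≤k) , eq) = c , (1≤c , m≤n⇒m≤1+n c≤k) , eq

progression-gap : ∀ {x y t} j e k → x ∈ progression j e k → y ∈ progression j e k →
  y ≡ x + t → 1 ≤ t → ∃[ b ] (1 ≤ b × b ≤ k) × t ≡ b * e
progression-gap {t = t} j e k x∈ y∈ y≡x+t 1≤t
  with ∈-progression⁻ j e k x∈ | ∈-progression⁻ j e k y∈
... | a , _ , refl | a′ , a′≤k , refl =
  a′ ∸ a , (m<n⇒0<n∸m a<a′ , ≤-trans (m∸n≤m a′ a) a′≤k) , t≡[a′∸a]e
  where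
  a′e≡ae+t : a′ * e ≡ a * e + t
  a′e≡ae+t = +-cancelˡ-≡ j _ _ (trans y≡x+t (+-assoc j (a * e) t))
  a<a′ : a < a′
  a<a′ = *-cancelʳ-< e a a′ (subst (a * e <_) (sym a′e≡ae+t) (m<m+n (a * e) 1≤t))
  t≡[a′∸a]e : t ≡ (a′ ∸ a) * e
  t≡[a′∸a]e = begin
    t                  ≡⟨ sym (m+n∸m≡n (a * e) t) ⟩
    a * e + t ∸ a * e  ≡⟨ cong (_∸ a * e) (sym a′e≡ae+t) ⟩
    a′ * e ∸ a * e     ≡⟨ sym (*-distribʳ-∸ e a′ a) ⟩
    (a′ ∸ a) * e       ∎
    where open ≡-Reasoning

2+d≤2*d : ∀ {d} → 2 ≤ d → 2 + d ≤ 2 * d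
2+d≤2*d {d} 2≤d = begin
  2 + d        ≡⟨ +-comm 2 d ⟩
  d + 2        ≤⟨ +-monoʳ-≤ d (≤-trans 2≤d (≤-reflexive (sym (+-identityʳ d)))) ⟩
  2 * d        ∎
  where open ≤-Reasoning

-- The hypothesis n ≥ 7 matters only for d = 1, where 1 + 4d = 5 does not make room for increment 3.
room-for-2+ : ∀ {n} d → 7 ≤ n → 1 + 2 * (2 * d) ≤ n → 1 + 2 * (2 + d) ≤ n
room-for-2+ zero          n≥7 _   = ≤-trans (m≤m+n 5 2) n≥7
room-for-2+ (suc zero)    n≥7 _   = n≥7
room-for-2+ (suc (suc _)) _   fit = ≤-trans (s≤s (*-monoʳ-≤ 2 (2+d≤2*d (s≤s (s≤s z≤n))))) fit

largestOddIncrement⇒n≤4d : ∀ {n d} → 7 ≤ n → LargestOddIncrement n 2 d → n ≤ 2 * (2 * d)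
largestOddIncrement⇒n≤4d {n} {d} n≥7 (odd , _ , largest) with n ≤? 2 * (2 * d)
... | yes n≤4d = n≤4d
... | no  n≰4d = contradiction (≤-trans (n≤1+n (suc d)) (largest (2 + d) (Odd-2+ odd) wide)) 1+n≰n
  where
  wide : IsIncrement n 2 (2 + d)
  wide = facet 1 (2 + d) (s≤s z≤n) (s≤s z≤n) (room-for-2+ d n≥7 (≰⇒> n≰4d)) , refl

module _ {n d} (n≥7 : 7 ≤ n) (largest : LargestOddIncrement n 2 d)
         (G : Facet n 2) (e≢d : increment G ≢ d) where

  private e = increment G

  no-common-gap : ∀ {c b} → 1 ≤ c → c ≤ 2 → 1 ≤ b → b ≤ 2 → c * d ≢ b * e
  no-common-gap 1≤c c≤2 1≤b b≤2 cd≡be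
    with 1≤c≤2⇒c≡1⊎c≡2 1≤c c≤2 | 1≤c≤2⇒c≡1⊎c≡2 1≤b b≤2
  ... | inj₁ refl | inj₁ refl = e≢d (sym (*-cancelˡ-≡ d e 1 cd≡be))
  ... | inj₂ refl | inj₂ refl = e≢d (sym (*-cancelˡ-≡ d e 2 cd≡be))
  ... | inj₁ refl | inj₂ refl = odd⇒≢double e (proj₁ largest) (trans (sym (*-identityˡ d)) cd≡be)
  ... | inj₂ refl | inj₁ refl =
    <⇒≱ (≤-trans (+-monoˡ-≤ (2 * (2 * d)) (start≥1 G)) G-fits) (largestOddIncrement⇒n≤4d n≥7 largest)
    where
    G-fits : start G + 2 * (2 * d) ≤ n
    G-fits = subst (λ x → start G + 2 * x ≤ n) (sym (trans cd≡be (*-identityˡ e))) (fits G)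

lemma3p1 : (n : ℕ) → 7 ≤ n → (d : ℕ) → LargestOddIncrement n 2 d →
    (F : Facet n 2) → increment F ≡ d →
    (G : Facet n 2) → increment G ≢ d →
    ∣ F ∩ G ∣ ≤ 1
lemma3p1 n n≥7 d largest F refl G e≢d =
  length-filter≤1 (_∈? vertices G) (AllPairs.map not-both-in-G (progression-gaps (start F) d 2))
  where
  not-both-in-G : ∀ {x y} → ∃[ c ] (1 ≤ c × c ≤ 2) × y ≡ x + c * d →
                  ¬ (x ∈ vertices G × y ∈ vertices G)
  not-both-in-G (c , (1≤c , c≤2) , y≡x+cd) (x∈G , y∈G)
    with progression-gap (start G) (increment G) 2 x∈G y∈G y≡x+cd (*-mono-≤ 1≤c (incr≥1 F))
  ... | b , (1≤b , b≤2) , cd≡be = no-common-gap n≥7 largest G e≢d 1≤c c≤2 1≤b b≤2 cd≡be
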